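{- Let $(\mathbf{d}_n)_{n\ge1}$ be a family of degree sequences with $\Delta(\mathbf{d}_n)=o\big(\sqrt{n\sigma^2(\mathbf{d}_n)}\big)$ and $\sigma^2(\mathbf{d}_n)=\omega\big(\log n/n^{1/3}\big)$ as $n\to\infty$. Then $m_3(\mathbf{d}_n)=o\big((n\sigma^2(\mathbf{d}_n))^{3/2}\big)$.
   Context: A degree sequence is $\mathbf{d}_n=(d_{n,1},\dots,d_{n,n})\in\mathbb{N}_0^n$ with $\sum_j d_{n,j}=n$. $\Delta(\mathbf{d}_n)=\max_j d_{n,j}$, $m_k(\mathbf{d}_n)=\sum_j d_{n,j}^k$, $\sigma^2(\mathbf{d}_n)=m_2(\mathbf{d}_n)/n-1$; $a_n=\omega(b_n)$ means $b_n=o(a_n)$. -}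

module Defs where

open import Data.Nat using (ℕ; suc; _+_; _*_; _∸_; _^_; _≤_; _⊔_)
open import Data.Vec using (Vec; sum; map; foldr′)
open import Data.Product using (Σ)
open import Relation.Binary.PropositionalEquality using (_≡_)

DegSeq : ℕ → Set
DegSeq n = Vec ℕ n

IsDegSeq : ∀ {n} → DegSeq n → Set
IsDegSeq {n} d = sum d ≡ n

Δ : ∀ {n} → DegSeq n → ℕ
Δ = foldr′ _⊔_ 0

m : ℕ → ∀ {n} → DegSeq n → ℕ
m k d = sum (map (λ x → x ^ k) d)

-- n · σ²(d) = m₂(d) − n  (exact, since m₂ ≥ Σ d_j = n for integer degrees)
nσ² : ∀ {n} → DegSeq n → ℕ
nσ² {n} d = m 2 d ∸ n

-- f = o(g) for ℕ-valued f, g, with ε = (1+p)/(1+q) ranging over all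
-- positive rationals:  ∀ ε > 0, ∃ N, ∀ n ≥ N, f n ≤ ε · g n.
IsLittleO : (ℕ → ℕ) → (ℕ → ℕ) → Set
IsLittleO f g =
  ∀ (p q : ℕ) → Σ ℕ λ N → ∀ n → N ≤ n → suc q * f n ≤ suc p * g n

{-# OPTIONS --safe #-}
-- For 0 ≤ x ≤ Δ we have x³ − x = (x+1)·(x² − x) ≤ 2Δ·(x² − x), since x² − x = 0 when x = 0
-- and x + 1 ≤ 2Δ otherwise. Summing over a degree sequence (Σ d_j = n) gives
-- m₃ ≤ n + 2Δ·nσ², hence m₃² ≤ 4n² + 16Δ²(nσ²)². The second term is o((nσ²)³) because
-- Δ² = o(nσ²), and the first because n² ≤ ⌊log₂ n⌋³ n² = o((nσ²)³) for n ≥ 2.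
module Submission where

open import Defs
open import Data.Nat using (ℕ; _*_; _^_; zero; suc; _+_; _∸_; _≤_; _⊔_; z≤n; s≤s; >-nonZero)
open import Data.Nat.Properties
open import Data.Nat.Logarithm using (⌊log₂_⌋; ⌊log₂⌋-mono-≤)
open import Data.Nat.Tactic.RingSolver using (solve-∀)
open import Data.Vec using (Vec; []; _∷_; sum)
open import Data.Product using (Σ; _,_)
open import Data.Sum using (inj₁; inj₂)
open import Relation.Binary.PropositionalEquality using (_≡_; refl; sym; cong; subst)

private
  variable
    f g h : ℕ → ℕ

-- `IsLittleO f g` unfolds to `∀ p q → Eventually (λ n → suc q * f n ≤ suc p * g n)`.
Eventually : (ℕ → Set) → Set
Eventually P = Σ ℕ λ N → ∀ n → N ≤ n → P n

eventually-map : ∀ {P Q : ℕ → Set} → (∀ {n} → P n → Q n) → Eventually P → Eventually Q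
eventually-map f (N , p) = N , λ n N≤n → f (p n N≤n)

eventually-map₂ : ∀ {P Q R : ℕ → Set} → (∀ {n} → P n → Q n → R n) →
                  Eventually P → Eventually Q → Eventually R
eventually-map₂ f (M , p) (N , q) =
  M ⊔ N , λ n M⊔N≤n → f (p n (m⊔n≤o⇒m≤o M N M⊔N≤n)) (q n (m⊔n≤o⇒n≤o M N M⊔N≤n))

littleO-≤ : Eventually (λ n → f n ≤ g n) → IsLittleO g h → IsLittleO f h
littleO-≤ f≤g g=o p q =
  eventually-map₂ (λ f≤g q*g≤p*h → ≤-trans (*-monoʳ-≤ (suc q) f≤g) q*g≤p*h) f≤g (g=o p q)

littleO-+ : IsLittleO f h → IsLittleO g h → IsLittleO (λ n → f n + g n) h
littleO-+ {f} {h} {g} f=o g=o p q =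
  -- suc (q + suc q) is 2 * suc q: each summand gets half of the allowed ratio.
  eventually-map₂ halves (f=o p (q + suc q)) (g=o p (q + suc q))
  where
  open ≤-Reasoning
  halves : ∀ {n} → suc (q + suc q) * f n ≤ suc p * h n → suc (q + suc q) * g n ≤ suc p * h n →
           suc q * (f n + g n) ≤ suc p * h n
  halves {n} f≤ g≤ = *-cancelˡ-≤ 2 (begin
    2 * (suc q * (f n + g n))                        ≡⟨ double-distrib q (f n) (g n) ⟩
    suc (q + suc q) * f n + suc (q + suc q) * g n    ≤⟨ +-mono-≤ f≤ g≤ ⟩
    suc p * h n + suc p * h n                        ≡⟨ sym (double (suc p * h n)) ⟩
    2 * (suc p * h n)                                ∎)
    where
    double-distrib : ∀ q a b → 2 * ((1 + q) * (a + b))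
                               ≡ (1 + (q + (1 + q))) * a + (1 + (q + (1 + q))) * b
    double-distrib = solve-∀
    double : ∀ a → 2 * a ≡ a + a
    double = solve-∀

littleO-*ˡ : ∀ k → IsLittleO f h → IsLittleO (λ n → k * f n) h
littleO-*ˡ {f} {h} k f=o p q = eventually-map scale (f=o p (k * suc q))
  where
  open ≤-Reasoning
  scale : ∀ {n} → suc (k * suc q) * f n ≤ suc p * h n → suc q * (k * f n) ≤ suc p * h n
  scale {n} ≤h = begin
    suc q * (k * f n)     ≡⟨ reassoc k q (f n) ⟩
    k * suc q * f n       ≤⟨ *-monoˡ-≤ (f n) (n≤1+n (k * suc q)) ⟩
    suc (k * suc q) * f n ≤⟨ ≤h ⟩
    suc p * h n           ∎
    where
    reassoc : ∀ k q a → (1 + q) * (k * a) ≡ k * (1 + q) * a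
    reassoc = solve-∀

littleO-*ʳ : ∀ (h : ℕ → ℕ) → IsLittleO f g → IsLittleO (λ n → f n * h n) (λ n → g n * h n)
littleO-*ʳ {f} {g} h f=o p q = eventually-map scale (f=o p q)
  where
  open ≤-Reasoning
  scale : ∀ {n} → suc q * f n ≤ suc p * g n → suc q * (f n * h n) ≤ suc p * (g n * h n)
  scale {n} ≤g = begin
    suc q * (f n * h n) ≡⟨ *-assoc (suc q) (f n) (h n) ⟨
    suc q * f n * h n   ≤⟨ *-monoˡ-≤ (h n) ≤g ⟩
    suc p * g n * h n   ≡⟨ *-assoc (suc p) (g n) (h n) ⟩
    suc p * (g n * h n) ∎

m+o≤n+p⇒m≤n+[p∸o] : ∀ m n o p → m + o ≤ n + p → m ≤ n + (p ∸ o)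
m+o≤n+p⇒m≤n+[p∸o] m n o p le with ≤-total o p
... | inj₁ o≤p = ≤-trans (m+n≤o⇒m≤o∸n m le) (≤-reflexive (+-∸-assoc n o≤p))
... | inj₂ p≤o = ≤-trans (+-cancelʳ-≤ o m n (≤-trans le (+-monoʳ-≤ n p≤o))) (m≤m+n n (p ∸ o))

[m+m]²≡4m² : ∀ m → (m + m) ^ 2 ≡ 4 * m ^ 2
[m+m]²≡4m² = identity
  where
  -- `solve-∀` does not support `_^_`, so ring identities are stated with powers unfolded.
  identity : ∀ a → (a + a) * ((a + a) * 1) ≡ 4 * (a * (a * 1))
  identity = solve-∀

[m+n]²≤4m²+4n² : ∀ m n → (m + n) ^ 2 ≤ 4 * m ^ 2 + 4 * n ^ 2
[m+n]²≤4m²+4n² m n with ≤-total m n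
... | inj₁ m≤n = ≤-trans (^-monoˡ-≤ 2 (+-monoˡ-≤ n m≤n))
                   (≤-trans (≤-reflexive ([m+m]²≡4m² n)) (m≤n+m (4 * n ^ 2) (4 * m ^ 2)))
... | inj₂ n≤m = ≤-trans (^-monoˡ-≤ 2 (+-monoʳ-≤ m n≤m))
                   (≤-trans (≤-reflexive ([m+m]²≡4m² m)) (m≤m+n (4 * m ^ 2) (4 * n ^ 2)))

m³+2Dm≤m+2Dm² : ∀ {m D} → m ≤ D → m ^ 3 + 2 * D * m ≤ m + 2 * D * m ^ 2
m³+2Dm≤m+2Dm² {zero}  _   = ≤-refl
m³+2Dm≤m+2Dm² {suc k} {D} m≤D = begin
  suc k ^ 3 + 2 * D * suc k                          ≡⟨ cube k D ⟩
  suc k * k * (2 + k) + (suc k + 2 * D * suc k)      ≤⟨ +-monoˡ-≤ _ (*-monoʳ-≤ (suc k * k) 2+k≤2D) ⟩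
  suc k * k * (2 * D) + (suc k + 2 * D * suc k)      ≡⟨ square k D ⟨
  suc k + 2 * D * suc k ^ 2                          ∎
  where
  open ≤-Reasoning
  2+k≤2D : 2 + k ≤ 2 * D
  2+k≤2D = ≤-trans (+-mono-≤ (≤-trans (s≤s z≤n) m≤D) m≤D) (≤-reflexive (double D))
    where
    double : ∀ a → a + a ≡ 2 * a
    double = solve-∀
  cube : ∀ k D → (1 + k) * ((1 + k) * ((1 + k) * 1)) + 2 * D * (1 + k)
                 ≡ (1 + k) * k * (2 + k) + ((1 + k) + 2 * D * (1 + k))
  cube = solve-∀
  square : ∀ k D → (1 + k) + 2 * D * ((1 + k) * ((1 + k) * 1))
                   ≡ (1 + k) * k * (2 * D) + ((1 + k) + 2 * D * (1 + k))
  square = solve-∀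

m₃+2DΣ≤Σ+2Dm₂ : ∀ {k D} (v : Vec ℕ k) → Δ v ≤ D → m 3 v + 2 * D * sum v ≤ sum v + 2 * D * m 2 v
m₃+2DΣ≤Σ+2Dm₂ []       _ = ≤-refl
m₃+2DΣ≤Σ+2Dm₂ {D = D} (x ∷ xs) x⊔Δ≤D = begin
  (x ^ 3 + m 3 xs) + c * (x + sum xs)        ≡⟨ interchange c (x ^ 3) (m 3 xs) x (sum xs) ⟨
  (x ^ 3 + c * x) + (m 3 xs + c * sum xs)    ≤⟨ +-mono-≤ (m³+2Dm≤m+2Dm² x≤D) (m₃+2DΣ≤Σ+2Dm₂ xs Δ≤D) ⟩
  (x + c * x ^ 2) + (sum xs + c * m 2 xs)    ≡⟨ interchange c x (sum xs) (x ^ 2) (m 2 xs) ⟩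
  (x + sum xs) + c * (x ^ 2 + m 2 xs)        ∎
  where
  open ≤-Reasoning
  c : ℕ
  c = 2 * D
  x≤D : x ≤ D
  x≤D = m⊔n≤o⇒m≤o x (Δ xs) x⊔Δ≤D
  Δ≤D : Δ xs ≤ D
  Δ≤D = m⊔n≤o⇒n≤o x (Δ xs) x⊔Δ≤D
  interchange : ∀ k a b c e → (a + k * c) + (b + k * e) ≡ (a + b) + k * (c + e)
  interchange = solve-∀

m₃≤n+2Δnσ² : ∀ {n} (v : DegSeq n) → IsDegSeq v → m 3 v ≤ n + 2 * Δ v * nσ² v
m₃≤n+2Δnσ² {n} v Σv≡n = begin
  m 3 v                              ≤⟨ m+o≤n+p⇒m≤n+[p∸o] (m 3 v) n (c * n) (c * m 2 v) bound ⟩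
  n + (c * m 2 v ∸ c * n)            ≡⟨ cong (n +_) (*-distribˡ-∸ c (m 2 v) n) ⟨
  n + c * nσ² v                      ∎
  where
  open ≤-Reasoning
  c : ℕ
  c = 2 * Δ v
  bound : m 3 v + c * n ≤ n + c * m 2 v
  bound = subst (λ s → m 3 v + c * s ≤ s + c * m 2 v) Σv≡n (m₃+2DΣ≤Σ+2Dm₂ v ≤-refl)

m₃²≤4n²+16Δ²[nσ²]² : ∀ {n} (v : DegSeq n) → IsDegSeq v →
                      m 3 v ^ 2 ≤ 4 * n ^ 2 + 16 * (Δ v ^ 2 * nσ² v ^ 2)
m₃²≤4n²+16Δ²[nσ²]² {n} v Σv≡n = begin
  m 3 v ^ 2                                   ≤⟨ ^-monoˡ-≤ 2 (m₃≤n+2Δnσ² v Σv≡n) ⟩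
  (n + 2 * Δ v * nσ² v) ^ 2                   ≤⟨ [m+n]²≤4m²+4n² n (2 * Δ v * nσ² v) ⟩
  4 * n ^ 2 + 4 * (2 * Δ v * nσ² v) ^ 2       ≡⟨ cong (4 * n ^ 2 +_) (square-product (Δ v) (nσ² v)) ⟩
  4 * n ^ 2 + 16 * (Δ v ^ 2 * nσ² v ^ 2)      ∎
  where
  open ≤-Reasoning
  square-product : ∀ a b → 4 * ((2 * a * b) * ((2 * a * b) * 1))
                           ≡ 16 * ((a * (a * 1)) * (b * (b * 1)))
  square-product = solve-∀

n²≤⌊log₂n⌋³n² : Eventually (λ n → n ^ 2 ≤ ⌊log₂ n ⌋ ^ 3 * n ^ 2)
n²≤⌊log₂n⌋³n² = 2 , λ n 2≤n →
  m≤n*m (n ^ 2) (⌊log₂ n ⌋ ^ 3) ⦃ >-nonZero (^-monoˡ-≤ 3 (⌊log₂⌋-mono-≤ 2≤n)) ⦄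

lemma3p8 : (d : (n : ℕ) → DegSeq n)
           → (∀ n → IsDegSeq (d n))
           → IsLittleO (λ n → Δ (d n) ^ 2) (λ n → nσ² (d n))
           → IsLittleO (λ n → (⌊log₂ n ⌋ ^ 3) * (n ^ 2)) (λ n → nσ² (d n) ^ 3)
           → IsLittleO (λ n → m 3 (d n) ^ 2) (λ n → nσ² (d n) ^ 3)
lemma3p8 d isDegSeq Δ²=o[nσ²] ⌊log₂n⌋³n²=o[nσ²³] =
  littleO-≤ (0 , λ n _ → m₃²≤4n²+16Δ²[nσ²]² (d n) (isDegSeq n))
    (littleO-+ (littleO-*ˡ 4 n²=o[nσ²³]) (littleO-*ˡ 16 Δ²[nσ²]²=o[nσ²³]))
  where
  n²=o[nσ²³] : IsLittleO (λ n → n ^ 2) (λ n → nσ² (d n) ^ 3)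
  n²=o[nσ²³] = littleO-≤ n²≤⌊log₂n⌋³n² ⌊log₂n⌋³n²=o[nσ²³]
  Δ²[nσ²]²=o[nσ²³] : IsLittleO (λ n → Δ (d n) ^ 2 * nσ² (d n) ^ 2) (λ n → nσ² (d n) ^ 3)
  Δ²[nσ²]²=o[nσ²³] = littleO-*ʳ (λ n → nσ² (d n) ^ 2) Δ²=o[nσ²]
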